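{- Let $(C_n,S)$ be an instance of cycle VCA, $\alpha\in(1/2,1]$, $N_{\max}\ge 1$, and let $F\subseteq S$ be $(\alpha,N_{\max})$-critical. Then every link $e\in S$ crosses at most one circle component of $\mathcal{L}(F)$.
   Context: Let $n\ge 4$ and let $C_n$ be the cycle on $[n]$ with edges $\{i,i+1\}$ and $\{n,1\}$. A chord is an edge between two non-consecutive vertices of $C_n$. Chords $ab$, $cd$ ($a<b$, $c<d$) cross if $a,b,c,d$ are distinct and $c<a<d<b$ or $a<c<b<d$. An instance of cycle VCA is a pair $(C_n,S)$, $S$ a set of chords (links) with $C_n\cup S$ 3-vertex-connected. For a set $L$ of chords, $V(L)$ is the set of vertices incident to chords of $L$; the circle graph of $L$ has vertex set $L$, two chords adjacent iff they cross. A set $F\subseteq S$ is singleton-free if its circle graph has no isolated vertex; $\mathcal{L}(F)$ is the family of link sets of connected components of its circle graph (these are circle components), and $U(F)=-|F|+\sum_{J\in\mathcal{L}(F)}(|V(J)|-3)$. A singleton-free $F$ is $(\alpha,N_{\max})$-critical if there is no $K\subseteq S\setminus F$ with $|K|\le N_{\max}$, $F\cup K$ singleton-free and $U(F\cup K)-U(F)\ge(1-\alpha)|V(F\cup K)\setminus V(F)|$. A chord $e$ crosses a component $J$ if it crosses some chord of $J$.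
   Formalization: The parameter α takes only rational values in $(1/2,1]$. -}

module Defs where

open import Data.Nat as ℕ using (ℕ; suc; _<_; _≤_)
import Data.Nat.Properties as ℕP
open import Data.Integer as ℤ using (ℤ; +_)
open import Data.Rational as ℚ using (ℚ; ½; 1ℚ)
open import Data.Product using (Σ; ∃; ∃-syntax; _×_; _,_)
open import Data.Product.Properties using (≡-dec)
open import Data.Sum using (_⊎_)
open import Data.Fin using (Fin)
open import Data.List using (List; []; _∷_; _++_; length; filter; concatMap; deduplicate; lookup; foldr; map)
open import Data.List.Membership.Propositional using (_∈_; _∉_)
open import Data.List.Membership.DecPropositional ℕ._≟_ using (_∈?_)
open import Data.List.Relation.Unary.All using (All)
open import Data.List.Relation.Unary.Unique.Propositional using (Unique)
open import Data.List.Relation.Binary.Permutation.Propositional using (_↭_)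
open import Relation.Binary.PropositionalEquality using (_≡_; _≢_)
open import Relation.Nullary using (¬_; ¬?)

-- Vertices of C_n are the naturals 1..n.  A chord / link is a pair (a , b)
-- with a < b (the normalised representation of the unordered pair {a,b}).

Chord : Set
Chord = ℕ × ℕ

IsChord : ℕ → Chord → Set
IsChord n (a , b) = 1 ≤ a × suc a < b × b ≤ n × ¬ (a ≡ 1 × b ≡ n)

Cross : Chord → Chord → Set
Cross (a , b) (c , d) = (c < a × a < d × d < b) ⊎ (a < c × c < b × b < d)

Adj : ℕ → List Chord → ℕ → ℕ → Set
Adj n S u v =
  suc u ≡ v ⊎ suc v ≡ u ⊎ (u ≡ 1 × v ≡ n) ⊎ (u ≡ n × v ≡ 1)
  ⊎ (u , v) ∈ S ⊎ (v , u) ∈ S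

data Walk (n : ℕ) (S : List Chord) (X : List ℕ) : ℕ → ℕ → Set where
  nil  : ∀ {u} → Walk n S X u u
  cons : ∀ {u v w} → Walk n S X u v → Adj n S v w →
         1 ≤ w → w ≤ n → w ∉ X → Walk n S X u w

ConnectedMinus : ℕ → List Chord → List ℕ → Set
ConnectedMinus n S X =
  ∀ u v → 1 ≤ u → u ≤ n → u ∉ X → 1 ≤ v → v ≤ n → v ∉ X → Walk n S X u v

ThreeConnected : ℕ → List Chord → Set
ThreeConnected n S = 3 < n × (∀ (X : List ℕ) → length X ≤ 2 → ConnectedMinus n S X)

CycleVCA : ℕ → List Chord → Set
CycleVCA n S = All (IsChord n) S × Unique S × ThreeConnected n S

SubsetOf : List Chord → List Chord → Set
SubsetOf F S = Unique F × All (_∈ S) F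

SingletonFree : List Chord → Set
SingletonFree F = All (λ c → ∃[ d ] (d ∈ F × Cross c d)) F

data Reach (F : List Chord) : Chord → Chord → Set where
  here : ∀ {c} → c ∈ F → Reach F c c
  step : ∀ {c d e} → Reach F c d → e ∈ F → Cross d e → Reach F c e

-- Ls is (a listing of) 𝓛(F): the link sets of the connected components of
-- the circle graph of F, i.e. a partition of F into nonempty blocks such that
-- two links lie in a common block iff they are connected in the circle graph.
IsComponents : List Chord → List (List Chord) → Set
IsComponents F Ls =
  foldr _++_ [] Ls ↭ F
  × All (λ J → ∃[ c ] (c ∈ J)) Ls
  × (∀ (i : Fin (length Ls)) c d → c ∈ lookup Ls i → d ∈ lookup Ls i → Reach F c d)
  × (∀ (i j : Fin (length Ls)) c d → i ≢ j →
       c ∈ lookup Ls i → d ∈ lookup Ls j → ¬ Reach F c d)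

V : List Chord → List ℕ
V L = deduplicate ℕ._≟_ (concatMap (λ { (a , b) → a ∷ b ∷ [] }) L)

sumℤ : List ℤ → ℤ
sumℤ = foldr ℤ._+_ (+ 0)

Uval : List Chord → List (List Chord) → ℤ
Uval F Ls = ℤ.- (+ length F) ℤ.+ sumℤ (map (λ J → + length (V J) ℤ.- + 3) Ls)

newVerts : List Chord → List Chord → ℕ
newVerts F K = length (filter (λ v → ¬? (v ∈? V F)) (V (F ++ K)))

toℚ : ℤ → ℚ
toℚ z = z ℚ./ 1

Improving : List Chord → ℚ → ℕ → List Chord → List Chord → Set
Improving S α Nmax F K =
  SubsetOf K S × All (_∉ F) K × 1 ≤ length K × length K ≤ Nmax
  × SingletonFree (F ++ K)
  × ∃[ LsFK ] ∃[ LsF ] (IsComponents (F ++ K) LsFK × IsComponents F LsF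
      × (1ℚ ℚ.- α) ℚ.* toℚ (+ newVerts F K)
          ℚ.≤ toℚ (Uval (F ++ K) LsFK ℤ.- Uval F LsF))

Critical : List Chord → ℚ → ℕ → List Chord → Set
Critical S α Nmax F = SingletonFree F × ¬ (∃[ K ] Improving S α Nmax F K)

CrossesComp : Chord → List Chord → Set
CrossesComp e J = ∃[ d ] (d ∈ J × Cross e d)

{-# OPTIONS --safe #-}
-- If e ∈ F, then e lies in a component of F and crosses no other one.  Otherwise suppose
-- e = ab crosses two distinct components.  Adding e merges the set T of components it
-- crosses (|T| ≥ 2) with e into one component M.  Vertex sets of distinct components
-- never interleave on the cycle; since e crosses all of T, every other member of T lies
-- in the gap of V(J) around a or the one around b, for a fixed J ∈ T.  The members on one
-- side together meet V(J) in at most the two vertices bounding that gap, and no vertex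
-- outside V(J) lies in both gaps; induction gives Σ_{J∈T} |V(J)| ≤ |V(⋃T)| + 2(|T| − 1).
-- Hence U(F ∪ {e}) − U(F) = |V(M)| − Σ_{J∈T} |V(J)| + 3|T| − 4 ≥ |V(F ∪ {e}) \ V(F)| + |T| − 2,
-- so {e} is an improving augmentation for every α ≥ 0, contradicting criticality.
module Submission where

module CircleComponents where

  open import Defs
  open import Data.Nat as ℕ using (ℕ; zero; suc; _+_; _*_; _∸_; _≤_; _<_; z≤n; s≤s)
  import Data.Nat.Properties as ℕP
  open import Data.Nat.ListAction using (sum)
  open import Data.Nat.ListAction.Properties using (sum-++; sum-↭)
  open import Data.Nat.Tactic.RingSolver using (solve-∀)
  open import Data.Integer as ℤ using (ℤ; +_)
  import Data.Integer.Properties as ℤP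
  import Data.Integer.Tactic.RingSolver as ℤSolver
  open import Data.Rational as ℚ using (ℚ; ½; 1ℚ; 0ℚ)
  import Data.Rational.Properties as ℚP
  import Data.Rational.Unnormalised as ℚᵘ
  import Data.Rational.Unnormalised.Properties as ℚᵘP
  open import Data.Fin as Fin using (Fin)
  import Data.Fin.Properties as FinP
  open import Data.List using (List; []; _∷_; _++_; [_]; length; filter; lookup; map; concat; concatMap; allFin; deduplicate)
  open import Data.List.Properties using (length-++; length-map; map-++; map-∘; ++-assoc; map-tabulate; tabulate-lookup; length-tabulate)
  open import Data.List.Membership.Propositional using (_∈_; _∉_; find; lose)
  open import Data.List.Membership.Propositional.Properties
  open import Data.List.Membership.DecPropositional ℕ._≟_ using (_∈?_)
  open import Data.List.Relation.Binary.Subset.Propositional using (_⊆_)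
  open import Data.List.Relation.Binary.Permutation.Propositional using (_↭_; ↭-refl; ↭-sym; ↭-trans; prep)
  open import Data.List.Relation.Binary.Permutation.Propositional.Properties
    using (∈-resp-↭; ↭-length; shift; shifts; map⁺; ++⁺ˡ; ++⁺ʳ; ∷↭∷ʳ)
  open import Data.List.Relation.Unary.Any as Any using (here; there; any?)
  import Data.List.Relation.Unary.Any.Properties as AnyP
  open import Data.List.Relation.Unary.All as All using (All; []; _∷_)
  import Data.List.Relation.Unary.All.Properties as AllP
  open import Data.List.Relation.Unary.AllPairs using ([]; _∷_)
  open import Data.List.Relation.Unary.Unique.Propositional using (Unique)
  open import Data.List.Relation.Unary.Unique.Propositional.Properties using (++⁺; filter⁺; allFin⁺)
  open import Data.List.Relation.Unary.Unique.DecPropositional.Properties using (deduplicate-!)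
  open import Data.Product using (∃₂; ∃-syntax; _×_; _,_; proj₁; proj₂)
  open import Data.Sum using (_⊎_; inj₁; inj₂; [_,_]′)
  open import Data.Empty using (⊥; ⊥-elim)
  open import Function using (_∘_; case_of_)
  open import Relation.Binary using (tri<; tri≈; tri>)
  open import Relation.Binary.PropositionalEquality hiding (J; [_])
  open import Relation.Nullary using (¬_; Dec; yes; no; ¬?; contradiction)
  open import Relation.Nullary.Decidable using (_×-dec_; _⊎-dec_; toWitness)
  open import Relation.Unary using (Decidable)

  module _ {A : Set} where

    Unique-⊆⇒length≤ : ∀ {xs ys : List A} → Unique xs → xs ⊆ ys → length xs ≤ length ys
    Unique-⊆⇒length≤ {[]} _ _ = z≤n
    Unique-⊆⇒length≤ {x ∷ xs} (x∉xs ∷ u) xs⊆ys =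
      let zs , |ys|≡ , keep = remove (xs⊆ys (here refl))
      in subst (suc (length xs) ≤_) (sym |ys|≡)
           (s≤s (Unique-⊆⇒length≤ u (λ y∈ → keep (xs⊆ys (there y∈)) (≢-sym (All.lookup x∉xs y∈)))))
      where
      remove : ∀ {x} {ys : List A} → x ∈ ys →
        ∃[ zs ] (length ys ≡ suc (length zs) × (∀ {y} → y ∈ ys → y ≢ x → y ∈ zs))
      remove {ys = y ∷ ys} (here refl) = ys , refl , λ { (here refl) y≢y → contradiction refl y≢y ; (there y∈) _ → y∈ }
      remove {ys = y ∷ ys} (there x∈) =
        let zs , |ys|≡ , keep = remove x∈
        in y ∷ zs , cong suc |ys|≡ , λ { (here refl) _ → here refl ; (there z∈) z≢x → there (keep z∈ z≢x) }

    2≤length : ∀ {x y : A} {xs} → x ∈ xs → y ∈ xs → x ≢ y → 2 ≤ length xs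
    2≤length {xs = _ ∷ []} (here refl) (here refl) x≢y = contradiction refl x≢y
    2≤length {xs = _ ∷ _ ∷ _} _ _ _ = s≤s (s≤s z≤n)

    module _ {P : A → Set} (P? : Decidable P) where

      filter++filter-¬↭ : ∀ xs → filter P? xs ++ filter (¬? ∘ P?) xs ↭ xs
      filter++filter-¬↭ [] = ↭-refl
      filter++filter-¬↭ (x ∷ xs) with P? x
      ... | yes _ = prep x (filter++filter-¬↭ xs)
      ... | no _ = ↭-trans (shift x (filter P? xs) (filter (¬? ∘ P?) xs)) (prep x (filter++filter-¬↭ xs))

      length-filter-split : ∀ xs → length xs ≡ length (filter P? xs) + length (filter (¬? ∘ P?) xs)
      length-filter-split xs = trans (sym (↭-length (filter++filter-¬↭ xs))) (length-++ (filter P? xs))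

      concatMap-filter-split : ∀ {B : Set} (f : A → List B) xs →
        concatMap f (filter P? xs) ++ concatMap f (filter (¬? ∘ P?) xs) ↭ concatMap f xs
      concatMap-filter-split f [] = ↭-refl
      concatMap-filter-split f (x ∷ xs) with P? x
      ... | yes _ = subst (_↭ f x ++ concatMap f xs) (sym (++-assoc (f x) _ _))
                      (++⁺ˡ (f x) (concatMap-filter-split f xs))
      ... | no _ = ↭-trans (shifts (concatMap f (filter P? xs)) (f x)) (++⁺ˡ (f x) (concatMap-filter-split f xs))

    partition-⊎ : ∀ {P Q : A → Set} {xs} → Unique xs → All (λ x → P x ⊎ Q x) xs →
      ∃₂ λ ys zs → All P ys × All Q zs × Unique ys × Unique zs × ys ++ zs ↭ xs
    partition-⊎ {xs = []} [] [] = [] , [] , [] , [] , [] , [] , ↭-refl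
    partition-⊎ {xs = x ∷ xs} (x∉xs ∷ u) (px⊎qx ∷ pqs) with partition-⊎ u pqs | px⊎qx
    ... | ys , zs , ps , qs , uys , uzs , σ | inj₁ px =
      x ∷ ys , zs , px ∷ ps , qs ,
      AllP.anti-mono (λ y∈ → ∈-resp-↭ σ (∈-++⁺ˡ y∈)) x∉xs ∷ uys , uzs , prep x σ
    ... | ys , zs , ps , qs , uys , uzs , σ | inj₂ qx =
      ys , x ∷ zs , ps , qx ∷ qs ,
      uys , AllP.anti-mono (λ z∈ → ∈-resp-↭ σ (∈-++⁺ʳ ys z∈)) x∉xs ∷ uzs , ↭-trans (shift x ys zs) (prep x σ)

  longer⇒∃∉ : ∀ {ws ys : List ℕ} → Unique ws → length ys < length ws → ∃[ w ] (w ∈ ws × w ∉ ys)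
  longer⇒∃∉ {ws} {ys} u |ys|<|ws| with any? (λ w → ¬? (w ∈? ys)) ws
  ... | yes w∉ = find w∉
  ... | no ¬w∉ = contradiction (Unique-⊆⇒length≤ u ws⊆ys) (ℕP.<⇒≱ |ys|<|ws|)
    where
    ws⊆ys : ws ⊆ ys
    ws⊆ys {w} w∈ with w ∈? ys
    ... | yes w∈ys = w∈ys
    ... | no w∉ys = contradiction (lose w∈ w∉ys) ¬w∉

  module _ {A B : Set} (f : A → B) where

    preimage : ∀ xs → Fin (length (map f xs)) → A
    preimage (x ∷ xs) Fin.zero = x
    preimage (x ∷ xs) (Fin.suc k) = preimage xs k

    lookup-map-preimage : ∀ xs k → lookup (map f xs) k ≡ f (preimage xs k)
    lookup-map-preimage (x ∷ xs) Fin.zero = refl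
    lookup-map-preimage (x ∷ xs) (Fin.suc k) = lookup-map-preimage xs k

    preimage∈ : ∀ xs k → preimage xs k ∈ xs
    preimage∈ (x ∷ xs) Fin.zero = here refl
    preimage∈ (x ∷ xs) (Fin.suc k) = there (preimage∈ xs k)

    preimage-injective : ∀ {xs} → Unique xs → ∀ k l → preimage xs k ≡ preimage xs l → k ≡ l
    preimage-injective {_ ∷ _} _ Fin.zero Fin.zero _ = refl
    preimage-injective {_ ∷ xs} (x∉xs ∷ _) Fin.zero (Fin.suc l) eq = contradiction eq (All.lookup x∉xs (preimage∈ xs l))
    preimage-injective {_ ∷ xs} (x∉xs ∷ _) (Fin.suc k) Fin.zero eq = contradiction (sym eq) (All.lookup x∉xs (preimage∈ xs k))
    preimage-injective {_ ∷ _} (_ ∷ u) (Fin.suc k) (Fin.suc l) eq = cong Fin.suc (preimage-injective u k l eq)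

  Reach-trans : ∀ {G c d x} → Reach G c d → Reach G d x → Reach G c x
  Reach-trans r (here _) = r
  Reach-trans r (step r′ x∈ cr) = step (Reach-trans r r′) x∈ cr

  Reach-mono : ∀ {G H c d} → G ⊆ H → Reach G c d → Reach H c d
  Reach-mono G⊆H (here c∈) = here (G⊆H c∈)
  Reach-mono G⊆H (step r d∈ cr) = step (Reach-mono G⊆H r) (G⊆H d∈) cr

  Reach⇒∈ : ∀ {G c d} → Reach G c d → d ∈ G
  Reach⇒∈ (here c∈) = c∈
  Reach⇒∈ (step _ d∈ _) = d∈

  Reach-invariant : ∀ {G} (P : Chord → Set) → (∀ {c d} → P c → d ∈ G → Cross c d → P d) →
    ∀ {c d} → Reach G c d → P c → P d
  Reach-invariant P preserve (here _) pc = pc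
  Reach-invariant P preserve (step r d∈ cr) pc = preserve (Reach-invariant P preserve r pc) d∈ cr

  Ordered : Chord → Set
  Ordered c = proj₁ c < proj₂ c

  IsChord⇒Ordered : ∀ {n c} → IsChord n c → Ordered c
  IsChord⇒Ordered chord = ℕP.<-trans (ℕP.n<1+n _) (proj₁ (proj₂ chord))

  Cross-sym : ∀ {c d} → Cross c d → Cross d c
  Cross-sym (inj₁ order) = inj₂ order
  Cross-sym (inj₂ order) = inj₁ order

  Cross? : ∀ c d → Dec (Cross c d)
  Cross? (a , b) (c , d) =
    ((c ℕ.<? a) ×-dec (a ℕ.<? d) ×-dec (d ℕ.<? b)) ⊎-dec ((a ℕ.<? c) ×-dec (c ℕ.<? b) ×-dec (b ℕ.<? d))

  Cross⇒endpoints-unique : ∀ {p q r s} → p < q → r < s → Cross (p , q) (r , s) → Unique (p ∷ q ∷ r ∷ s ∷ [])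
  Cross⇒endpoints-unique p<q r<s (inj₁ (r<p , p<s , s<q)) =
    (ℕP.<⇒≢ p<q ∷ ℕP.>⇒≢ r<p ∷ ℕP.<⇒≢ p<s ∷ []) ∷ (ℕP.>⇒≢ (ℕP.<-trans r<p p<q) ∷ ℕP.>⇒≢ s<q ∷ []) ∷
    (ℕP.<⇒≢ r<s ∷ []) ∷ [] ∷ []
  Cross⇒endpoints-unique p<q r<s (inj₂ (p<r , r<q , q<s)) =
    (ℕP.<⇒≢ p<q ∷ ℕP.<⇒≢ p<r ∷ ℕP.<⇒≢ (ℕP.<-trans p<r r<s) ∷ []) ∷ (ℕP.>⇒≢ r<q ∷ ℕP.<⇒≢ q<s ∷ []) ∷
    (ℕP.<⇒≢ r<s ∷ []) ∷ [] ∷ []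

  Inside Outside Within Beyond : ℕ → ℕ → ℕ → Set
  Inside x y v = x < v × v < y
  Outside x y v = v < x ⊎ y < v
  Within x y v = x ≤ v × v ≤ y
  Beyond x y v = v ≤ x ⊎ y ≤ v

  Inside⇒¬Beyond : ∀ {x y v} → Inside x y v → ¬ Beyond x y v
  Inside⇒¬Beyond (x<v , _) (inj₁ v≤x) = ℕP.<⇒≱ x<v v≤x
  Inside⇒¬Beyond (_ , v<y) (inj₂ y≤v) = ℕP.<⇒≱ v<y y≤v

  Both : (ℕ → Set) → Chord → Set
  Both P c = P (proj₁ c) × P (proj₂ c)

  ¬Cross⇒within⊎beyond : ∀ x y c → Ordered c → ¬ Cross c (x , y) → Both (Within x y) c ⊎ Both (Beyond x y) c
  ¬Cross⇒within⊎beyond x y (p , q) p<q ¬cr with p ℕ.≤? x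
  ... | yes p≤x with q ℕ.≤? x
  ...   | yes q≤x = inj₂ (inj₁ p≤x , inj₁ q≤x)
  ...   | no q≰x with y ℕ.≤? q
  ...     | yes y≤q = inj₂ (inj₁ p≤x , inj₂ y≤q)
  ...     | no y≰q with p ℕ.≟ x
  ...       | yes refl = inj₁ ((ℕP.≤-refl , ℕP.≤-trans (ℕP.<⇒≤ p<q) (ℕP.<⇒≤ (ℕP.≰⇒> y≰q))) , (ℕP.<⇒≤ p<q , ℕP.<⇒≤ (ℕP.≰⇒> y≰q)))
  ...       | no p≢x = contradiction (inj₂ (ℕP.≤∧≢⇒< p≤x p≢x , ℕP.≰⇒> q≰x , ℕP.≰⇒> y≰q)) ¬cr
  ¬Cross⇒within⊎beyond x y (p , q) p<q ¬cr | no p≰x with y ℕ.≤? p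
  ... | yes y≤p = inj₂ (inj₂ y≤p , inj₂ (ℕP.≤-trans y≤p (ℕP.<⇒≤ p<q)))
  ... | no y≰p with q ℕ.≤? y
  ...   | yes q≤y = inj₁ ((ℕP.<⇒≤ (ℕP.≰⇒> p≰x) , ℕP.<⇒≤ (ℕP.≰⇒> y≰p)) , (ℕP.<⇒≤ (ℕP.<-trans (ℕP.≰⇒> p≰x) p<q) , q≤y))
  ...   | no q≰y = contradiction (inj₁ (ℕP.≰⇒> p≰x , ℕP.≰⇒> y≰p , ℕP.≰⇒> q≰y)) ¬cr

  within-beyond-¬Cross : ∀ {x y c d} → Both (Within x y) c → Both (Beyond x y) d → ¬ Cross c d
  within-beyond-¬Cross ((x≤p , p≤y) , (x≤q , q≤y)) (_ , s-beyond) (inj₁ (_ , p<s , s<q)) =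
    Inside⇒¬Beyond (ℕP.≤-<-trans x≤p p<s , ℕP.<-≤-trans s<q q≤y) s-beyond
  within-beyond-¬Cross ((x≤p , p≤y) , (x≤q , q≤y)) (r-beyond , _) (inj₂ (p<r , r<q , _)) =
    Inside⇒¬Beyond (ℕP.≤-<-trans x≤p p<r , ℕP.<-≤-trans r<q q≤y) r-beyond

  infix 4 _∈ᵥ_
  _∈ᵥ_ : ℕ → List Chord → Set
  v ∈ᵥ X = ∃[ c ] (c ∈ X × (v ≡ proj₁ c ⊎ v ≡ proj₂ c))

  endpoints : List Chord → List ℕ
  endpoints [] = []
  endpoints (c ∷ X) = proj₁ c ∷ proj₂ c ∷ endpoints X

  V≡deduplicate-endpoints : ∀ X → V X ≡ deduplicate ℕ._≟_ (endpoints X)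
  V≡deduplicate-endpoints X = cong (deduplicate ℕ._≟_) (concatMap-endpoints _ (λ _ → refl) X)
    where
    concatMap-endpoints : ∀ (f : Chord → List ℕ) → (∀ c → f c ≡ proj₁ c ∷ proj₂ c ∷ []) →
      ∀ X → concatMap f X ≡ endpoints X
    concatMap-endpoints f f≡ [] = refl
    concatMap-endpoints f f≡ (c ∷ X) = cong₂ _++_ (f≡ c) (concatMap-endpoints f f≡ X)

  ∈ᵥ⇒∈V : ∀ X {v} → v ∈ᵥ X → v ∈ V X
  ∈ᵥ⇒∈V X v∈ rewrite V≡deduplicate-endpoints X = ∈-deduplicate⁺ ℕ._≟_ (∈-endpoints X v∈)
    where
    ∈-endpoints : ∀ X {v} → v ∈ᵥ X → v ∈ endpoints X
    ∈-endpoints (c ∷ X) (c , here refl , inj₁ refl) = here refl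
    ∈-endpoints (c ∷ X) (c , here refl , inj₂ refl) = there (here refl)
    ∈-endpoints (c ∷ X) (d , there d∈ , v≡) = there (there (∈-endpoints X (d , d∈ , v≡)))

  ∈V⇒∈ᵥ : ∀ X {v} → v ∈ V X → v ∈ᵥ X
  ∈V⇒∈ᵥ X v∈ rewrite V≡deduplicate-endpoints X = endpoints-∈ X (∈-deduplicate⁻ ℕ._≟_ (endpoints X) v∈)
    where
    endpoints-∈ : ∀ X {v} → v ∈ endpoints X → v ∈ᵥ X
    endpoints-∈ (c ∷ X) (here refl) = c , here refl , inj₁ refl
    endpoints-∈ (c ∷ X) (there (here refl)) = c , here refl , inj₂ refl
    endpoints-∈ (c ∷ X) (there (there v∈)) =
      let d , d∈ , v≡ = endpoints-∈ X v∈ in d , there d∈ , v≡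

  V-unique : ∀ X → Unique (V X)
  V-unique X rewrite V≡deduplicate-endpoints X = deduplicate-! ℕ._≟_ (endpoints X)

  ∃-vertex? : ∀ X {Q : ℕ → Set} → (∀ v → Dec (Q v)) → Dec (∃[ v ] (v ∈ᵥ X × Q v))
  ∃-vertex? X Q? with any? Q? (V X)
  ... | yes any = let v , v∈ , q = find any in yes (v , ∈V⇒∈ᵥ X v∈ , q)
  ... | no ¬any = no λ (v , v∈ , q) → ¬any (lose (∈ᵥ⇒∈V X v∈) q)

  onV offV : List Chord → List ℕ → List ℕ
  onV X = filter (_∈? V X)
  offV X = filter (¬? ∘ (_∈? V X))

  crossing⇒inside-outside : ∀ {a b X} → CrossesComp (a , b) X →
    (∃[ s ] (s ∈ᵥ X × Inside a b s)) × (∃[ t ] (t ∈ᵥ X × Outside a b t))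
  crossing⇒inside-outside ((c , d) , d∈ , inj₁ (c<a , a<d , d<b)) =
    (d , ((c , d) , d∈ , inj₂ refl) , a<d , d<b) , (c , ((c , d) , d∈ , inj₁ refl) , inj₁ c<a)
  crossing⇒inside-outside ((c , d) , d∈ , inj₂ (a<c , c<b , b<d)) =
    (c , ((c , d) , d∈ , inj₁ refl) , a<c , c<b) , (d , ((c , d) , d∈ , inj₂ refl) , inj₂ b<d)

  -- Moving from g to v upwards (resp. downwards) on the cycle, wrapping around
  -- past n if necessary, passes no vertex of X strictly before v.
  module _ (X : List Chord) where

    ClearUp ClearDown InGap : ℕ → ℕ → Set
    ClearUp g v = (g ≤ v × (∀ {j} → j ∈ᵥ X → ¬ Inside g v j))
                ⊎ ((∀ {j} → j ∈ᵥ X → j < g) × (∀ {j} → j ∈ᵥ X → v ≤ j))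
    ClearDown g v = (v ≤ g × (∀ {j} → j ∈ᵥ X → ¬ Inside v g j))
                  ⊎ ((∀ {j} → j ∈ᵥ X → g < j) × (∀ {j} → j ∈ᵥ X → j ≤ v))
    InGap g v = ClearUp g v ⊎ ClearDown g v

  LiesInGap : List Chord → List Chord → ℕ → Set
  LiesInGap X P g = ¬ g ∈ᵥ X × (∀ {v} → v ∈ᵥ P → InGap X g v)

  Nested : List Chord → List Chord → Set
  Nested X P = ∃[ p ] (p ∈ᵥ P × ∃[ j ] (j ∈ᵥ X × p < j × ∃[ q ] (q ∈ᵥ P × j < q)))

  Nested? : ∀ X P → Dec (Nested X P)
  Nested? X P = ∃-vertex? P λ p → ∃-vertex? X λ j → (p ℕ.<? j) ×-dec ∃-vertex? P (j ℕ.<?_)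

  ¬Nested⇒∉ : ∀ {X P p q j} → ¬ Nested X P → p ∈ᵥ P → q ∈ᵥ P → Inside p q j → ¬ j ∈ᵥ X
  ¬Nested⇒∉ ¬nested p∈ q∈ (p<j , j<q) j∈ = ¬nested (_ , p∈ , _ , j∈ , p<j , _ , q∈ , j<q)

  module _ {X : List Chord} {g : ℕ} (g∉X : ¬ g ∈ᵥ X) where

    private
      g≢ : ∀ {u} → u ∈ᵥ X → g ≢ u
      g≢ u∈ refl = g∉X u∈

    ClearUp-unique : ∀ {u v} → u ∈ᵥ X → v ∈ᵥ X → ClearUp X g u → ClearUp X g v → u ≡ v
    ClearUp-unique {u} {v} u∈ v∈ (inj₁ (g≤u , ¬u)) (inj₁ (g≤v , ¬v)) with ℕP.<-cmp u v
    ... | tri< u<v _ _ = contradiction (ℕP.≤∧≢⇒< g≤u (g≢ u∈) , u<v) (¬v u∈)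
    ... | tri≈ _ u≡v _ = u≡v
    ... | tri> _ _ v<u = contradiction (ℕP.≤∧≢⇒< g≤v (g≢ v∈) , v<u) (¬u v∈)
    ClearUp-unique u∈ v∈ (inj₁ (g≤u , _)) (inj₂ (X<g , _)) = contradiction g≤u (ℕP.<⇒≱ (X<g u∈))
    ClearUp-unique u∈ v∈ (inj₂ (X<g , _)) (inj₁ (g≤v , _)) = contradiction g≤v (ℕP.<⇒≱ (X<g v∈))
    ClearUp-unique u∈ v∈ (inj₂ (_ , u≤X)) (inj₂ (_ , v≤X)) = ℕP.≤-antisym (u≤X v∈) (v≤X u∈)

    ClearDown-unique : ∀ {u v} → u ∈ᵥ X → v ∈ᵥ X → ClearDown X g u → ClearDown X g v → u ≡ v
    ClearDown-unique {u} {v} u∈ v∈ (inj₁ (u≤g , ¬u)) (inj₁ (v≤g , ¬v)) with ℕP.<-cmp u v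
    ... | tri< u<v _ _ = contradiction (u<v , ℕP.≤∧≢⇒< v≤g (≢-sym (g≢ v∈))) (¬u v∈)
    ... | tri≈ _ u≡v _ = u≡v
    ... | tri> _ _ v<u = contradiction (v<u , ℕP.≤∧≢⇒< u≤g (≢-sym (g≢ u∈))) (¬v u∈)
    ClearDown-unique u∈ v∈ (inj₁ (u≤g , _)) (inj₂ (g<X , _)) = contradiction u≤g (ℕP.<⇒≱ (g<X u∈))
    ClearDown-unique u∈ v∈ (inj₂ (g<X , _)) (inj₁ (v≤g , _)) = contradiction v≤g (ℕP.<⇒≱ (g<X v∈))
    ClearDown-unique u∈ v∈ (inj₂ (_ , X≤u)) (inj₂ (_ , X≤v)) = ℕP.≤-antisym (X≤v u∈) (X≤u v∈)

    InGap∩X-length≤2 : ∀ {Z} → Unique Z → (∀ {z} → z ∈ Z → z ∈ᵥ X × InGap X g z) → length Z ≤ 2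
    InGap∩X-length≤2 {[]} _ _ = z≤n
    InGap∩X-length≤2 {_ ∷ []} _ _ = s≤s z≤n
    InGap∩X-length≤2 {_ ∷ _ ∷ []} _ _ = s≤s (s≤s z≤n)
    InGap∩X-length≤2 {_ ∷ _ ∷ _ ∷ _} ((x≢y ∷ x≢z ∷ _) ∷ (y≢z ∷ _) ∷ _) inGap =
      ⊥-elim (three x≢y x≢z y≢z (inGap (here refl)) (inGap (there (here refl))) (inGap (there (there (here refl)))))
      where
      three : ∀ {x y z} → x ≢ y → x ≢ z → y ≢ z →
        x ∈ᵥ X × InGap X g x → y ∈ᵥ X × InGap X g y → z ∈ᵥ X × InGap X g z → ⊥
      three x≢y _ _ (x∈ , inj₁ ux) (y∈ , inj₁ uy) _ = x≢y (ClearUp-unique x∈ y∈ ux uy)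
      three x≢y _ _ (x∈ , inj₂ dx) (y∈ , inj₂ dy) _ = x≢y (ClearDown-unique x∈ y∈ dx dy)
      three _ x≢z _ (x∈ , inj₁ ux) (_ , inj₂ _) (z∈ , inj₁ uz) = x≢z (ClearUp-unique x∈ z∈ ux uz)
      three _ _ y≢z (_ , inj₁ _) (y∈ , inj₂ dy) (z∈ , inj₂ dz) = y≢z (ClearDown-unique y∈ z∈ dy dz)
      three _ _ y≢z (_ , inj₂ _) (y∈ , inj₁ uy) (z∈ , inj₁ uz) = y≢z (ClearUp-unique y∈ z∈ uy uz)
      three _ x≢z _ (x∈ , inj₂ dx) (_ , inj₁ _) (z∈ , inj₂ dz) = x≢z (ClearDown-unique x∈ z∈ dx dz)

  module _ {a b : ℕ} {X : List Chord} where

    InGap-both⇒∈ᵥ : a < b → CrossesComp (a , b) X → ∀ {v} → InGap X a v → InGap X b v → v ∈ᵥ X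
    InGap-both⇒∈ᵥ a<b cr {v} ga gb =
      let (s , s∈ , a<s , s<b) , (t , t∈ , t-out) = crossing⇒inside-outside cr
      in meet s∈ a<s s<b t∈ ga gb t-out
      where
      meet : ∀ {s t} → s ∈ᵥ X → a < s → s < b → t ∈ᵥ X → InGap X a v → InGap X b v → Outside a b t → v ∈ᵥ X
      meet s∈ a<s s<b t∈ (inj₁ (inj₂ (X<a , _))) _ _ = contradiction (X<a s∈) (ℕP.<⇒≯ a<s)
      meet s∈ a<s s<b t∈ _ (inj₂ (inj₂ (b<X , _))) _ = contradiction (b<X s∈) (ℕP.<⇒≯ s<b)
      meet s∈ a<s s<b t∈ (inj₁ (inj₁ (a≤v , ¬a))) (inj₁ (inj₁ (b≤v , _))) _ =
        contradiction (a<s , ℕP.<-≤-trans s<b b≤v) (¬a s∈)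
      meet {s} s∈ a<s s<b t∈ (inj₁ (inj₁ (a≤v , ¬a))) (inj₂ (inj₁ (v≤b , ¬b))) _ with ℕP.<-cmp s v
      ... | tri< s<v _ _ = contradiction (a<s , s<v) (¬a s∈)
      ... | tri≈ _ refl _ = s∈
      ... | tri> _ _ v<s = contradiction (v<s , s<b) (¬b s∈)
      meet s∈ a<s s<b t∈ (inj₁ (inj₁ (a≤v , _))) (inj₁ (inj₂ (_ , v≤X))) (inj₁ t<a) =
        contradiction (ℕP.≤-trans a≤v (v≤X t∈)) (ℕP.<⇒≱ t<a)
      meet s∈ a<s s<b t∈ _ (inj₁ (inj₂ (X<b , _))) (inj₂ b<t) = contradiction (X<b t∈) (ℕP.<⇒≯ b<t)
      meet s∈ a<s s<b t∈ (inj₂ (inj₁ (v≤a , _))) (inj₁ (inj₁ (b≤v , _))) _ =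
        contradiction (ℕP.≤-trans b≤v v≤a) (ℕP.<⇒≱ a<b)
      meet s∈ a<s s<b t∈ (inj₂ (inj₁ (v≤a , _))) (inj₂ (inj₁ (_ , ¬b))) _ =
        contradiction (ℕP.≤-<-trans v≤a a<s , s<b) (¬b s∈)
      meet {t = t} s∈ a<s s<b t∈ (inj₂ (inj₁ (v≤a , ¬a))) (inj₁ (inj₂ (_ , v≤X))) (inj₁ t<a) with ℕP.<-cmp v t
      ... | tri< v<t _ _ = contradiction (v<t , t<a) (¬a t∈)
      ... | tri≈ _ refl _ = t∈
      ... | tri> _ _ t<v = contradiction (v≤X t∈) (ℕP.<⇒≱ t<v)
      meet s∈ a<s s<b t∈ (inj₂ (inj₂ (a<X , _))) _ (inj₁ t<a) = contradiction (a<X t∈) (ℕP.<⇒≯ t<a)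
      meet {t = t} s∈ a<s s<b t∈ (inj₂ (inj₂ (_ , X≤v))) (inj₁ (inj₁ (b≤v , ¬b))) (inj₂ b<t) with ℕP.<-cmp t v
      ... | tri< t<v _ _ = contradiction (b<t , t<v) (¬b t∈)
      ... | tri≈ _ refl _ = t∈
      ... | tri> _ _ v<t = contradiction (X≤v t∈) (ℕP.<⇒≱ v<t)
      meet s∈ a<s s<b t∈ (inj₂ (inj₂ (_ , X≤v))) (inj₂ (inj₁ (v≤b , _))) (inj₂ b<t) =
        contradiction (ℕP.≤-trans (X≤v t∈) v≤b) (ℕP.<⇒≱ b<t)

    ¬Nested⇒LiesInGap : ∀ {P} → CrossesComp (a , b) P → ¬ Nested X P → LiesInGap X P a ⊎ LiesInGap X P b
    ¬Nested⇒LiesInGap {P} cr ¬nested with crossing⇒inside-outside cr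
    ... | (s , s∈ , a<s , s<b) , (t , t∈ , inj₁ t<a) = inj₁ (¬Nested⇒∉ ¬nested t∈ s∈ (t<a , a<s) , gap)
      where
      gap : ∀ {v} → v ∈ᵥ P → InGap X a v
      gap {v} v∈ with a ℕ.≤? v
      ... | yes a≤v = inj₁ (inj₁ (a≤v , λ j∈ (a<j , j<v) → ¬Nested⇒∉ ¬nested t∈ v∈ (ℕP.<-trans t<a a<j , j<v) j∈))
      ... | no a≰v = inj₂ (inj₁ (ℕP.<⇒≤ (ℕP.≰⇒> a≰v) , λ j∈ (v<j , j<a) → ¬Nested⇒∉ ¬nested v∈ s∈ (v<j , ℕP.<-trans j<a a<s) j∈))
    ... | (s , s∈ , a<s , s<b) , (t , t∈ , inj₂ b<t) = inj₂ (¬Nested⇒∉ ¬nested s∈ t∈ (s<b , b<t) , gap)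
      where
      gap : ∀ {v} → v ∈ᵥ P → InGap X b v
      gap {v} v∈ with b ℕ.≤? v
      ... | yes b≤v = inj₁ (inj₁ (b≤v , λ j∈ (b<j , j<v) → ¬Nested⇒∉ ¬nested s∈ v∈ (ℕP.<-trans s<b b<j , j<v) j∈))
      ... | no b≰v = inj₂ (inj₁ (ℕP.<⇒≤ (ℕP.≰⇒> b≰v) , λ j∈ (v<j , j<b) → ¬Nested⇒∉ ¬nested v∈ t∈ (v<j , ℕP.<-trans j<b b<t) j∈))

    ¬Nested-in⇒LiesInGap : ∀ {P} → CrossesComp (a , b) X → CrossesComp (a , b) P → ¬ Nested P X →
      LiesInGap X P a ⊎ LiesInGap X P b
    ¬Nested-in⇒LiesInGap {P} cr-X cr-P ¬nested
      with proj₁ (crossing⇒inside-outside cr-P) | proj₂ (crossing⇒inside-outside cr-X)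
    ... | s , s∈ , a<s , s<b | o , o∈ , inj₁ o<a = inj₂ ((λ b∈ → ℕP.<⇒≱ s<b (X≤s b∈)) , gap)
      where
      X≤s : ∀ {j} → j ∈ᵥ X → j ≤ s
      X≤s j∈ = ℕP.≮⇒≥ λ s<j → ¬Nested⇒∉ ¬nested o∈ j∈ (ℕP.<-trans o<a a<s , s<j) s∈
      gap : ∀ {v} → v ∈ᵥ P → InGap X b v
      gap {v} v∈ with b ℕ.≤? v | ∃-vertex? X (v ℕ.<?_)
      ... | yes b≤v | _ = inj₁ (inj₁ (b≤v , λ j∈ (b<j , _) → ℕP.<⇒≱ (ℕP.<-trans s<b b<j) (X≤s j∈)))
      ... | no b≰v | yes (j₀ , j₀∈ , v<j₀) =
        inj₁ (inj₂ ((λ j∈ → ℕP.≤-<-trans (X≤s j∈) s<b) ,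
                    λ j∈ → ℕP.≮⇒≥ λ j<v → ¬Nested⇒∉ ¬nested j∈ j₀∈ (j<v , v<j₀) v∈))
      ... | no b≰v | no ¬above = inj₂ (inj₁ (ℕP.<⇒≤ (ℕP.≰⇒> b≰v) , λ j∈ (v<j , _) → ¬above (_ , j∈ , v<j)))
    ... | s , s∈ , a<s , s<b | o , o∈ , inj₂ b<o = inj₁ ((λ a∈ → ℕP.<⇒≱ a<s (s≤X a∈)) , gap)
      where
      s≤X : ∀ {j} → j ∈ᵥ X → s ≤ j
      s≤X j∈ = ℕP.≮⇒≥ λ j<s → ¬Nested⇒∉ ¬nested j∈ o∈ (j<s , ℕP.<-trans s<b b<o) s∈
      gap : ∀ {v} → v ∈ᵥ P → InGap X a v
      gap {v} v∈ with v ℕ.≤? a | ∃-vertex? X (ℕ._<? v)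
      ... | yes v≤a | _ = inj₂ (inj₁ (v≤a , λ j∈ (_ , j<a) → ℕP.<⇒≱ (ℕP.<-trans j<a a<s) (s≤X j∈)))
      ... | no v≰a | yes (j₀ , j₀∈ , j₀<v) =
        inj₂ (inj₂ ((λ j∈ → ℕP.<-≤-trans a<s (s≤X j∈)) ,
                    λ j∈ → ℕP.≮⇒≥ λ v<j → ¬Nested⇒∉ ¬nested j₀∈ j∈ (j₀<v , v<j) v∈))
      ... | no v≰a | no ¬below = inj₁ (inj₁ (ℕP.<⇒≤ (ℕP.≰⇒> v≰a) , λ j∈ (_ , j<v) → ¬below (_ , j∈ , j<v)))

  private
    +-2*-suc : ∀ o s → (2 + o) + 2 * s ≡ o + 2 * suc s
    +-2*-suc = solve-∀

    regroup : ∀ o a b c d → o + ((a + c) + (b + d)) ≡ (o + (a + b)) + (c + d)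
    regroup = solve-∀

  ΣV : List (List Chord) → ℕ
  ΣV Ks = sum (map (length ∘ V) Ks)

  private
    sumℤ-step : ∀ (v s t : ℤ) → (v ℤ.- + 3) ℤ.+ (s ℤ.- t) ≡ (v ℤ.+ s) ℤ.- (+ 3 ℤ.+ t)
    sumℤ-step = ℤSolver.solve-∀

    neg-step : ∀ (x s t : ℤ) → ℤ.- x ℤ.+ (s ℤ.- t) ≡ s ℤ.- (x ℤ.+ t)
    neg-step = ℤSolver.solve-∀

    difference-≡ : ∀ (a b c d : ℤ) → (a ℤ.- b) ℤ.- (c ℤ.- d) ≡ (a ℤ.+ d) ℤ.- (c ℤ.+ b)
    difference-≡ = ℤSolver.solve-∀

    slack-≡ : ∀ (n x y s : ℤ) → (n ℤ.+ x ℤ.+ y ℤ.+ s) ℤ.- (x ℤ.+ y) ≡ n ℤ.+ s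
    slack-≡ = ℤSolver.solve-∀

  sumℤ-≡ : ∀ Ks → sumℤ (map (λ K → + length (V K) ℤ.- + 3) Ks) ≡ + ΣV Ks ℤ.- + (3 * length Ks)
  sumℤ-≡ [] = refl
  sumℤ-≡ (K ∷ Ks) =
    trans (cong (ℤ._+_ (+ length (V K) ℤ.- + 3)) (sumℤ-≡ Ks))
      (trans (sumℤ-step (+ length (V K)) (+ ΣV Ks) (+ (3 * length Ks)))
        (cong (λ k → + (length (V K) + ΣV Ks) ℤ.- + k) (sym (ℕP.*-suc 3 (length Ks)))))

  Uval-≡ : ∀ X Ks → Uval X Ks ≡ + ΣV Ks ℤ.- + (length X + 3 * length Ks)
  Uval-≡ X Ks =
    trans (cong (ℤ._+_ (ℤ.- (+ length X))) (sumℤ-≡ Ks)) (neg-step (+ length X) (+ ΣV Ks) (+ (3 * length Ks)))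

  +≤-difference : ∀ {n a b c d} → n + c + b ≤ a + d → + n ℤ.≤ (+ a ℤ.- + b) ℤ.- (+ c ℤ.- + d)
  +≤-difference {n} {a} {b} {c} {d} h =
    subst (+ n ℤ.≤_) (sym difference) (ℤ.+≤+ (ℕP.m≤m+n n slack))
    where
    slack = (a + d) ∸ (n + c + b)
    difference : (+ a ℤ.- + b) ℤ.- (+ c ℤ.- + d) ≡ + (n + slack)
    difference = trans (difference-≡ (+ a) (+ b) (+ c) (+ d))
      (trans (cong (ℤ._- (+ c ℤ.+ + b)) (sym (cong +_ (ℕP.m+[n∸m]≡n h))))
        (slack-≡ (+ n) (+ c) (+ b) (+ slack)))

  private
    lhs-≡ : ∀ new s r f k → new + (s + r) + ((f + 1) + 3 * suc k) ≡ (new + s + 1) + (r + f + 3 * k + 3)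
    lhs-≡ = solve-∀

    rhs-≡ : ∀ vM r f t k → (vM + r) + (f + 3 * (suc t + k)) ≡ (vM + 3 * t) + (r + f + 3 * k + 3)
    rhs-≡ = solve-∀

    core-≡ : ∀ new v t → new + (v + 2 * t) + 1 ≡ (new + v) + (1 + 2 * t)
    core-≡ = solve-∀

  -- s = Σ_{J∈T} |V(J)|, r = the same sum over the k components not crossed by e, f = |F|,
  -- |T| = 1 + t, v = |V(⋃T)|, vM = |V(M)|.
  gain-arithmetic : ∀ {new s r f k t v vM} → s ≤ v + 2 * t → new + v ≤ vM → 1 ≤ t →
    new + (s + r) + ((f + 1) + 3 * suc k) ≤ (vM + r) + (f + 3 * (suc t + k))
  gain-arithmetic {new} {s} {r} {f} {k} {t} {v} {vM} s≤ new+v≤ 1≤t =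
    subst₂ _≤_ (sym (lhs-≡ new s r f k)) (sym (rhs-≡ vM r f t k)) (ℕP.+-monoˡ-≤ (r + f + 3 * k + 3) core)
    where
    open ℕP.≤-Reasoning
    core : new + s + 1 ≤ vM + 3 * t
    core = begin
      new + s + 1               ≤⟨ ℕP.+-monoˡ-≤ 1 (ℕP.+-monoʳ-≤ new s≤) ⟩
      new + (v + 2 * t) + 1     ≡⟨ core-≡ new v t ⟩
      (new + v) + (1 + 2 * t)   ≤⟨ ℕP.+-mono-≤ new+v≤ (ℕP.+-monoˡ-≤ (2 * t) 1≤t) ⟩
      vM + 3 * t                ∎

  toℚ-mono : ∀ {z w} → z ℤ.≤ w → toℚ z ℚ.≤ toℚ w
  toℚ-mono {z} {w} z≤w = ℚP.toℚᵘ-cancel-≤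
    (ℚᵘP.≤-respʳ-≃ (ℚᵘP.≃-sym (ℚP.toℚᵘ-fromℚᵘ (ℚᵘ.mkℚᵘ w 0)))
    (ℚᵘP.≤-respˡ-≃ (ℚᵘP.≃-sym (ℚP.toℚᵘ-fromℚᵘ (ℚᵘ.mkℚᵘ z 0)))
    (ℚᵘ.*≤* (subst₂ ℤ._≤_ (sym (ℤP.*-identityʳ z)) (sym (ℤP.*-identityʳ w)) z≤w))))

  scaled-≤ : ∀ {α m D} → 0ℚ ℚ.≤ α → + m ℤ.≤ D → (1ℚ ℚ.- α) ℚ.* toℚ (+ m) ℚ.≤ toℚ D
  scaled-≤ {α} {m} 0≤α m≤D = ℚP.≤-trans (ℚP.*-monoʳ-≤-nonNeg (toℚ (+ m)) 1-α≤1)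
    (ℚP.≤-trans (ℚP.≤-reflexive (ℚP.*-identityˡ (toℚ (+ m)))) (toℚ-mono m≤D))
    where
    instance
      m-nonNeg : ℚ.NonNegative (toℚ (+ m))
      m-nonNeg = ℚP.normalize-nonNeg m 1
    1-α≤1 : 1ℚ ℚ.- α ℚ.≤ 1ℚ
    1-α≤1 = ℚP.≤-trans (ℚP.+-monoʳ-≤ 1ℚ (ℚP.neg-antimono-≤ 0≤α)) (ℚP.≤-reflexive (ℚP.+-identityʳ 1ℚ))

  ½<⇒0≤ : ∀ {α} → ½ ℚ.< α → 0ℚ ℚ.≤ α
  ½<⇒0≤ ½<α = ℚP.≤-trans (toWitness {a? = 0ℚ ℚ.≤? ½} _) (ℚP.<⇒≤ ½<α)

  module Components {F : List Chord} {Ls : List (List Chord)} (comps : IsComponents F Ls) where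

    J : Fin (length Ls) → List Chord
    J = lookup Ls

    J⊆F : ∀ {i} → J i ⊆ F
    J⊆F {i} c∈ = ∈-resp-↭ (proj₁ comps) (∈-concat⁺′ {xss = Ls} c∈ (∈-lookup {xs = Ls} i))

    J-nonempty : ∀ i → ∃[ c ] (c ∈ J i)
    J-nonempty i = All.lookup (proj₁ (proj₂ comps)) (∈-lookup i)

    J-connected : ∀ i {c d} → c ∈ J i → d ∈ J i → Reach F c d
    J-connected i = proj₁ (proj₂ (proj₂ comps)) i _ _

    ∃-component : ∀ {c} → c ∈ F → ∃[ i ] (c ∈ J i)
    ∃-component c∈ =
      let c∈some = ∈-concat⁻ Ls (∈-resp-↭ (↭-sym (proj₁ comps)) c∈)
      in Any.index c∈some , AnyP.lookup-index c∈some

    private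
      separated : ∀ {i m c d} → i ≢ m → c ∈ J i → d ∈ J m → ¬ Reach F c d
      separated {i} {m} i≢m = proj₂ (proj₂ (proj₂ comps)) i m _ _ i≢m

    component-unique : ∀ {c i m} → c ∈ J i → c ∈ J m → i ≡ m
    component-unique {i = i} {m} c∈i c∈m with i FinP.≟ m
    ... | yes i≡m = i≡m
    ... | no i≢m = contradiction (here (J⊆F c∈i)) (separated i≢m c∈i c∈m)

    Reach-closed : ∀ {c d i} → c ∈ J i → Reach F c d → d ∈ J i
    Reach-closed {i = i} c∈ r with ∃-component (Reach⇒∈ r)
    ... | m , d∈ with i FinP.≟ m
    ... | yes refl = d∈
    ... | no i≢m = contradiction r (separated i≢m c∈ d∈)

    Cross-closed : ∀ {c d i} → c ∈ J i → d ∈ F → Cross c d → d ∈ J i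
    Cross-closed c∈ d∈ cr = Reach-closed c∈ (step (here (J⊆F c∈)) d∈ cr)

    Cross⇒same-component : ∀ {c d i m} → c ∈ J i → d ∈ J m → Cross c d → i ≡ m
    Cross⇒same-component c∈ d∈ cr = component-unique (Cross-closed c∈ (J⊆F d∈) cr) d∈

    crossed-by-member : ∀ {e} → e ∈ F → ∀ {i j} → CrossesComp e (J i) → CrossesComp e (J j) → i ≡ j
    crossed-by-member e∈ (d , d∈ , cr) (d′ , d′∈ , cr′) =
      let m , e∈m = ∃-component e∈
      in trans (sym (Cross⇒same-component e∈m d∈ cr)) (Cross⇒same-component e∈m d′∈ cr′)

  module Interleaving {F : List Chord} {Ls : List (List Chord)} (comps : IsComponents F Ls)
    (ordered : All Ordered F) (singleton-free : SingletonFree F) where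

    open Components comps

    private
      ordered-J : ∀ {i c} → c ∈ J i → Ordered c
      ordered-J c∈ = All.lookup ordered (J⊆F c∈)

      Both-propagates : ∀ i {W : ℕ → Set} {c₀} → c₀ ∈ J i → Both W c₀ →
        (∀ {c d} → Both W c → d ∈ J i → Cross c d → Both W d) → ∀ {v} → v ∈ᵥ J i → W v
      Both-propagates i {W} c₀∈ w₀ keep (d , d∈ , v≡) =
        endpoint v≡ (proj₂ (Reach-invariant (λ c → c ∈ J i × Both W c) preserve (J-connected i c₀∈ d∈) (c₀∈ , w₀)))
        where
        preserve : ∀ {c d} → c ∈ J i × Both W c → d ∈ F → Cross c d → d ∈ J i × Both W d
        preserve (c∈ , wc) d∈F cr = let d∈ = Cross-closed c∈ d∈F cr in d∈ , keep wc d∈ cr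
        endpoint : ∀ {v d} → v ≡ proj₁ d ⊎ v ≡ proj₂ d → Both W d → W v
        endpoint (inj₁ refl) = proj₁
        endpoint (inj₂ refl) = proj₂

      classify : ∀ {i x y} → (∀ {c} → c ∈ J i → ¬ Cross c (x , y)) →
        ∀ {d} → d ∈ J i → Both (Within x y) d ⊎ Both (Beyond x y) d
      classify {x = x} {y} ¬cross {d} d∈ = ¬Cross⇒within⊎beyond x y d (ordered-J d∈) (¬cross d∈)

    within⊎beyond : ∀ i {x y} → (∀ {c} → c ∈ J i → ¬ Cross c (x , y)) →
      (∀ {v} → v ∈ᵥ J i → Within x y v) ⊎ (∀ {v} → v ∈ᵥ J i → Beyond x y v)
    within⊎beyond i {x} {y} ¬cross with J-nonempty i
    ... | c₀ , c₀∈ with classify ¬cross c₀∈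
    ... | inj₁ w₀ = inj₁ (Both-propagates i c₀∈ w₀ λ wc d∈ cr →
            [ (λ wd → wd) , (λ bd → contradiction cr (within-beyond-¬Cross wc bd)) ]′ (classify ¬cross d∈))
    ... | inj₂ b₀ = inj₂ (Both-propagates i c₀∈ b₀ λ bc d∈ cr →
            [ (λ wd → contradiction (Cross-sym cr) (within-beyond-¬Cross wd bc)) , (λ bd → bd) ]′ (classify ¬cross d∈))

    no-interleaving : ∀ {i m} → i ≢ m → ∀ {x₁ y₁ x₂ y₂} → x₁ ∈ᵥ J i → y₁ ∈ᵥ J m → x₂ ∈ᵥ J i → y₂ ∈ᵥ J m →
      x₁ < y₁ → y₁ < x₂ → x₂ < y₂ → ⊥
    no-interleaving {i} {m} i≢m {x₁} {y₁} {x₂} {y₂} x₁∈ y₁∈ x₂∈ y₂∈ x₁<y₁ y₁<x₂ x₂<y₂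
      with any? (λ d → Cross? d (x₁ , x₂)) (J m)
    ... | no ¬cross with within⊎beyond m (λ d∈ cr → ¬cross (lose d∈ cr))
    ...   | inj₁ within = ℕP.<⇒≱ x₂<y₂ (proj₂ (within y₂∈))
    ...   | inj₂ beyond = Inside⇒¬Beyond (x₁<y₁ , y₁<x₂) (beyond y₁∈)
    no-interleaving {i} {m} i≢m x₁∈ y₁∈ x₂∈ y₂∈ x₁<y₁ y₁<x₂ x₂<y₂ | yes cross
      with find cross
    ... | (s , t) , st∈ , st-cross with within⊎beyond i (λ c∈ cr → i≢m (Cross⇒same-component c∈ st∈ cr)) | st-cross
    ...   | inj₁ within | inj₁ (x₁<s , _ , _) = ℕP.<⇒≱ x₁<s (proj₁ (within x₁∈))
    ...   | inj₂ beyond | inj₁ (_ , s<x₂ , x₂<t) = Inside⇒¬Beyond (s<x₂ , x₂<t) (beyond x₂∈)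
    ...   | inj₁ within | inj₂ (_ , _ , t<x₂) = ℕP.<⇒≱ t<x₂ (proj₂ (within x₂∈))
    ...   | inj₂ beyond | inj₂ (s<x₁ , x₁<t , _) = Inside⇒¬Beyond (s<x₁ , x₁<t) (beyond x₁∈)

    ∃-vertex-avoiding : ∀ i x y z → ∃[ w ] (w ∈ᵥ J i × w ≢ x × w ≢ y × w ≢ z)
    ∃-vertex-avoiding i x y z with J-nonempty i
    ... | c , c∈ with All.lookup singleton-free (J⊆F c∈)
    ... | d , d∈F , cr
      with longer⇒∃∉ {ys = x ∷ y ∷ z ∷ []} (Cross⇒endpoints-unique (ordered-J c∈) (All.lookup ordered d∈F) cr) ℕP.≤-refl
    ... | w , w∈ , w∉ = w , vertex w∈ , (w∉ ∘ here) , (w∉ ∘ there ∘ here) , (w∉ ∘ there ∘ there ∘ here)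
      where
      d∈ = Cross-closed c∈ d∈F cr
      vertex : ∀ {u} → u ∈ proj₁ c ∷ proj₂ c ∷ proj₁ d ∷ proj₂ d ∷ [] → u ∈ᵥ J i
      vertex (here refl) = c , c∈ , inj₁ refl
      vertex (there (here refl)) = c , c∈ , inj₂ refl
      vertex (there (there (here refl))) = d , d∈ , inj₁ refl
      vertex (there (there (there (here refl)))) = d , d∈ , inj₂ refl

    nested⇒within : ∀ {i m} → i ≢ m → ∀ {p j q} → p ∈ᵥ J m → j ∈ᵥ J i → q ∈ᵥ J m → p < j → j < q →
      ∀ {w} → w ∈ᵥ J i → Within p q w
    nested⇒within i≢m p∈ j∈ q∈ p<j j<q w∈ =
      ℕP.≮⇒≥ (λ w<p → no-interleaving i≢m w∈ p∈ j∈ q∈ w<p p<j j<q) ,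
      ℕP.≮⇒≥ (λ q<w → no-interleaving (≢-sym i≢m) p∈ j∈ q∈ w∈ p<j j<q q<w)

    shared-vertex-interleaves : ∀ {i m} → i ≢ m → ∀ {p j q j₁ j₂} →
      p ∈ᵥ J m → j ∈ᵥ J m → q ∈ᵥ J m → j₁ ∈ᵥ J i → j ∈ᵥ J i → j₂ ∈ᵥ J i →
      p < j → j < q → j₁ < j → j < j₂ → ⊥
    shared-vertex-interleaves {i} i≢m {p} {j} {q} p∈ j∈m q∈ j₁∈ j∈i j₂∈ p<j j<q j₁<j j<j₂ =
      let w , w∈ , w≢p , w≢j , w≢q = ∃-vertex-avoiding i p j q
          p≤w , w≤q = nested⇒within i≢m p∈ j∈i q∈ p<j j<q w∈
      in case ℕP.<-cmp w j of λ where
        (tri< w<j _ _) → no-interleaving (≢-sym i≢m) p∈ w∈ j∈m j₂∈ (ℕP.≤∧≢⇒< p≤w (≢-sym w≢p)) w<j j<j₂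
        (tri≈ _ w≡j _) → w≢j w≡j
        (tri> _ _ j<w) → no-interleaving i≢m j₁∈ j∈m w∈ q∈ j₁<j j<w (ℕP.≤∧≢⇒< w≤q w≢q)

    nesting-one-way : ∀ {i m} → i ≢ m → Nested (J i) (J m) → ¬ Nested (J m) (J i)
    nesting-one-way i≢m (p , p∈ , j , j∈ , p<j , q , q∈ , j<q) (j₁ , j₁∈ , r , r∈ , j₁<r , j₂ , j₂∈ , r<j₂)
      with ℕP.<-cmp r j
    ... | tri< r<j _ _ = no-interleaving i≢m j₁∈ r∈ j∈ q∈ j₁<r r<j j<q
    ... | tri≈ _ refl _ = shared-vertex-interleaves i≢m p∈ r∈ q∈ j₁∈ j∈ j₂∈ p<j j<q j₁<r r<j₂
    ... | tri> _ _ j<r = no-interleaving (≢-sym i≢m) p∈ j∈ r∈ j₂∈ p<j j<r r<j₂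

  module CrossingLink {F : List Chord} {Ls : List (List Chord)} (comps : IsComponents F Ls)
    (ordered : All Ordered F) (singleton-free : SingletonFree F) {a b : ℕ} (a<b : a < b) where

    open Components comps
    open Interleaving comps ordered singleton-free

    Crossed : Fin (length Ls) → Set
    Crossed t = CrossesComp (a , b) (J t)

    Crossed? : ∀ t → Dec (Crossed t)
    Crossed? t with any? (Cross? (a , b)) (J t)
    ... | yes cross = yes (find cross)
    ... | no ¬cross = no λ (d , d∈ , cr) → ¬cross (lose d∈ cr)

    gap-side : ∀ {t m} → t ≢ m → Crossed t → Crossed m → LiesInGap (J t) (J m) a ⊎ LiesInGap (J t) (J m) b
    gap-side {t} {m} t≢m cr-t cr-m with Nested? (J t) (J m)
    ... | yes nested = ¬Nested-in⇒LiesInGap cr-t cr-m (nesting-one-way t≢m nested)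
    ... | no ¬nested = ¬Nested⇒LiesInGap cr-m ¬nested

    ⋃ : List (Fin (length Ls)) → List Chord
    ⋃ = concatMap J

    ∈⋃⁻ : ∀ T {c} → c ∈ ⋃ T → ∃[ t ] (t ∈ T × c ∈ J t)
    ∈⋃⁻ T c∈ = find (∈-concatMap⁻ J c∈)

    ∈⋃⁺ : ∀ {T c t} → t ∈ T → c ∈ J t → c ∈ ⋃ T
    ∈⋃⁺ t∈ c∈ = ∈-concatMap⁺ J (lose t∈ c∈)

    ∈ᵥ⋃⁻ : ∀ T {v} → v ∈ᵥ ⋃ T → ∃[ t ] (t ∈ T × v ∈ᵥ J t)
    ∈ᵥ⋃⁻ T (c , c∈ , v≡) = let t , t∈ , c∈t = ∈⋃⁻ T c∈ in t , t∈ , c , c∈t , v≡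

    ∈ᵥ⋃⁺ : ∀ {T v t} → t ∈ T → v ∈ᵥ J t → v ∈ᵥ ⋃ T
    ∈ᵥ⋃⁺ t∈ (c , c∈ , v≡) = c , ∈⋃⁺ t∈ c∈ , v≡

    size : Fin (length Ls) → ℕ
    size t = length (V (J t))

    Σsize : List (Fin (length Ls)) → ℕ
    Σsize T = sum (map size T)

    Σsize-↭ : ∀ ys zs {xs} → ys ++ zs ↭ xs → Σsize xs ≡ Σsize ys + Σsize zs
    Σsize-↭ ys zs σ =
      trans (sum-↭ (map⁺ size (↭-sym σ))) (trans (cong sum (map-++ size ys zs)) (sum-++ (map size ys) (map size zs)))

    side-bound : ∀ {t g m S} → Σsize (m ∷ S) ≤ length (V (⋃ (m ∷ S))) + 2 * length S →
      All (λ k → LiesInGap (J t) (J k) g) (m ∷ S) →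
      Σsize (m ∷ S) ≤ length (offV (J t) (V (⋃ (m ∷ S)))) + 2 * length (m ∷ S)
    side-bound {t} {g} {m} {S} bound gaps@((g∉X , _) ∷ _) = begin
        Σsize (m ∷ S)                                           ≤⟨ bound ⟩
        length U + 2 * length S                                 ≡⟨ cong (_+ 2 * length S) (length-filter-split (_∈? V X) U) ⟩
        (length (onV X U) + length (offV X U)) + 2 * length S
          ≤⟨ ℕP.+-monoˡ-≤ (2 * length S) (ℕP.+-monoˡ-≤ (length (offV X U)) shared≤2) ⟩
        (2 + length (offV X U)) + 2 * length S                  ≡⟨ +-2*-suc (length (offV X U)) (length S) ⟩
        length (offV X U) + 2 * length (m ∷ S)                  ∎
      where
      open ℕP.≤-Reasoning
      X = J t
      U = V (⋃ (m ∷ S))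
      shared≤2 : length (onV X U) ≤ 2
      shared≤2 = InGap∩X-length≤2 g∉X (filter⁺ (_∈? V X) (V-unique (⋃ (m ∷ S)))) λ z∈ →
        let z∈U , z∈X = ∈-filter⁻ (_∈? V X) {xs = U} z∈
            k , k∈ , z∈k = ∈ᵥ⋃⁻ (m ∷ S) (∈V⇒∈ᵥ (⋃ (m ∷ S)) z∈U)
        in ∈V⇒∈ᵥ X z∈X , proj₂ (All.lookup gaps k∈) z∈k

    vertex-count : ∀ {t T A B} → Crossed t → A ⊆ T → B ⊆ T →
      All (λ m → LiesInGap (J t) (J m) a) A → All (λ m → LiesInGap (J t) (J m) b) B →
      size t + (length (offV (J t) (V (⋃ A))) + length (offV (J t) (V (⋃ B)))) ≤ length (V (⋃ (t ∷ T)))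
    vertex-count {t} {T} {A} {B} cr-t A⊆T B⊆T gaps-A gaps-B =
      subst (_≤ length (V (⋃ (t ∷ T)))) (trans (length-++ (V X)) (cong (_+_ (size t)) (length-++ off-A)))
        (Unique-⊆⇒length≤ Z-unique Z⊆)
      where
      X = J t
      off-A = offV X (V (⋃ A))
      off-B = offV X (V (⋃ B))

      off⇒ : ∀ {g S} → S ⊆ T → All (λ m → LiesInGap X (J m) g) S → ∀ {v} → v ∈ offV X (V (⋃ S)) →
        v ∉ V X × InGap X g v × v ∈ V (⋃ (t ∷ T))
      off⇒ {S = S} S⊆T gaps v∈ =
        let v∈U , v∉X = ∈-filter⁻ (¬? ∘ (_∈? V X)) {xs = V (⋃ S)} v∈
            k , k∈ , v∈k = ∈ᵥ⋃⁻ S (∈V⇒∈ᵥ (⋃ S) v∈U)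
        in v∉X , proj₂ (All.lookup gaps k∈) v∈k , ∈ᵥ⇒∈V (⋃ (t ∷ T)) (∈ᵥ⋃⁺ (there (S⊆T k∈)) v∈k)

      Z-unique : Unique (V X ++ (off-A ++ off-B))
      Z-unique = ++⁺ (V-unique X) (++⁺ (filter⁺ (¬? ∘ (_∈? V X)) (V-unique (⋃ A))) (filter⁺ (¬? ∘ (_∈? V X)) (V-unique (⋃ B))) A∩B) X∩AB
        where
        A∩B : ∀ {v} → ¬ (v ∈ off-A × v ∈ off-B)
        A∩B (v∈A , v∈B) =
          let v∉X , gap-a , _ = off⇒ A⊆T gaps-A v∈A
              _ , gap-b , _ = off⇒ B⊆T gaps-B v∈B
          in v∉X (∈ᵥ⇒∈V X (InGap-both⇒∈ᵥ a<b cr-t gap-a gap-b))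
        X∩AB : ∀ {v} → ¬ (v ∈ V X × v ∈ off-A ++ off-B)
        X∩AB (v∈X , v∈AB) with ∈-++⁻ off-A v∈AB
        ... | inj₁ v∈A = proj₁ (off⇒ A⊆T gaps-A v∈A) v∈X
        ... | inj₂ v∈B = proj₁ (off⇒ B⊆T gaps-B v∈B) v∈X

      Z⊆ : V X ++ (off-A ++ off-B) ⊆ V (⋃ (t ∷ T))
      Z⊆ v∈ with ∈-++⁻ (V X) v∈
      ... | inj₁ v∈X = ∈ᵥ⇒∈V (⋃ (t ∷ T)) (∈ᵥ⋃⁺ {t ∷ T} (here refl) (∈V⇒∈ᵥ X v∈X))
      ... | inj₂ v∈AB with ∈-++⁻ off-A v∈AB
      ...   | inj₁ v∈A = proj₂ (proj₂ (off⇒ A⊆T gaps-A v∈A))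
      ...   | inj₂ v∈B = proj₂ (proj₂ (off⇒ B⊆T gaps-B v∈B))

    private
      Bound : ℕ → Set
      Bound n = ∀ t T → length T < n → Unique (t ∷ T) → All Crossed (t ∷ T) →
        Σsize (t ∷ T) ≤ length (V (⋃ (t ∷ T))) + 2 * length T

      -- Splitting the other components by the gap of J t they lie in, each side meets J t in at most two vertices.
      bound-step : ∀ {n} → Bound n → ∀ t T → length T ≤ n → Unique (t ∷ T) → All Crossed (t ∷ T) →
        Σsize (t ∷ T) ≤ length (V (⋃ (t ∷ T))) + 2 * length T
      bound-step {n} ih t T |T|≤n (t∉T ∷ T-unique) (cr-t ∷ cr-T)
        with partition-⊎ T-unique (All.zipWith (λ (t≢m , cr-m) → gap-side t≢m cr-t cr-m) (t∉T , cr-T))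
      ... | A , B , gaps-A , gaps-B , A-unique , B-unique , σ = begin
          Σsize (t ∷ T)                                         ≡⟨ cong (_+_ (size t)) (Σsize-↭ A B σ) ⟩
          size t + (Σsize A + Σsize B)                          ≤⟨ ℕP.+-monoʳ-≤ (size t) (ℕP.+-mono-≤
                                                                     (side A⊆T A-unique gaps-A) (side B⊆T B-unique gaps-B)) ⟩
          size t + ((length off-A + 2 * length A) + (length off-B + 2 * length B))
                                                                ≡⟨ regroup (size t) (length off-A) (length off-B) _ _ ⟩
          (size t + (length off-A + length off-B)) + (2 * length A + 2 * length B)
                                                                ≤⟨ ℕP.+-monoˡ-≤ _ (vertex-count cr-t A⊆T B⊆T gaps-A gaps-B) ⟩
          length (V (⋃ (t ∷ T))) + (2 * length A + 2 * length B) ≡⟨ cong (_+_ (length (V (⋃ (t ∷ T))))) |T|≡ ⟩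
          length (V (⋃ (t ∷ T))) + 2 * length T                 ∎
        where
        open ℕP.≤-Reasoning
        off-A = offV (J t) (V (⋃ A))
        off-B = offV (J t) (V (⋃ B))
        A⊆T : A ⊆ T
        A⊆T m∈ = ∈-resp-↭ σ (∈-++⁺ˡ m∈)
        B⊆T : B ⊆ T
        B⊆T m∈ = ∈-resp-↭ σ (∈-++⁺ʳ A m∈)
        |T|≡ : 2 * length A + 2 * length B ≡ 2 * length T
        |T|≡ = trans (sym (ℕP.*-distribˡ-+ 2 (length A) (length B)))
                 (cong (2 *_) (trans (sym (length-++ A)) (↭-length σ)))
        side : ∀ {g S} → S ⊆ T → Unique S → All (λ m → LiesInGap (J t) (J m) g) S →
          Σsize S ≤ length (offV (J t) (V (⋃ S))) + 2 * length S
        side {S = []} _ _ _ = z≤n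
        side {S = m ∷ S} S⊆T S-unique gaps =
          side-bound (ih m S (ℕP.<-≤-trans (Unique-⊆⇒length≤ S-unique S⊆T) |T|≤n) S-unique
                        (All.tabulate (All.lookup (cr-t ∷ cr-T) ∘ there ∘ S⊆T))) gaps

      bound : ∀ n → Bound n
      bound zero _ _ ()
      bound (suc n) t T |T|<n = bound-step (bound n) t T (ℕP.≤-pred |T|<n)

    shared-vertices-bound : ∀ t T → Unique (t ∷ T) → All Crossed (t ∷ T) →
      Σsize (t ∷ T) ≤ length (V (⋃ (t ∷ T))) + 2 * length T
    shared-vertices-bound t T = bound (suc (length T)) t T ℕP.≤-refl

  module Merging {F : List Chord} {Ls : List (List Chord)} (comps : IsComponents F Ls)
    (ordered : All Ordered F) (singleton-free : SingletonFree F) {a b : ℕ} (a<b : a < b)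
    (e∉F : (a , b) ∉ F) where

    open Components comps
    open CrossingLink comps ordered singleton-free a<b

    e : Chord
    e = a , b

    T R : List (Fin (length Ls))
    T = filter Crossed? (allFin (length Ls))
    R = filter (¬? ∘ Crossed?) (allFin (length Ls))

    M : List Chord
    M = e ∷ ⋃ T

    merged : List (List Chord)
    merged = M ∷ map J R

    private
      F⊆ : F ⊆ F ++ [ e ]
      F⊆ = ∈-++⁺ˡ

      e∈ : e ∈ F ++ [ e ]
      e∈ = ∈-++⁺ʳ F (here refl)

      T⁻ : ∀ {t} → t ∈ T → Crossed t
      T⁻ t∈ = proj₂ (∈-filter⁻ Crossed? {xs = allFin _} t∈)

      T⁺ : ∀ {t} → Crossed t → t ∈ T
      T⁺ {t} cr = ∈-filter⁺ Crossed? (∈-allFin t) cr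

      R⁻ : ∀ {r} → r ∈ R → ¬ Crossed r
      R⁻ r∈ = proj₂ (∈-filter⁻ (¬? ∘ Crossed?) {xs = allFin _} r∈)

      map-J-allFin : map J (allFin (length Ls)) ≡ Ls
      map-J-allFin = trans (map-tabulate (λ k → k) J) (tabulate-lookup Ls)

    merged-components : IsComponents (F ++ [ e ]) merged
    merged-components = partition , (e , here refl) ∷ AllP.map⁺ (All.tabulate (λ {r} _ → J-nonempty r)) , connected , separated
      where
      partition : concat merged ↭ F ++ [ e ]
      partition = ↭-trans (∷↭∷ʳ e (⋃ T ++ ⋃ R)) (++⁺ʳ [ e ] (↭-trans (concatMap-filter-split Crossed? J (allFin _))
                    (subst (_↭ F) (cong concat (sym map-J-allFin)) (proj₁ comps))))

      to-e : ∀ {c} → c ∈ M → Reach (F ++ [ e ]) c e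
      to-e (here refl) = here e∈
      to-e (there c∈) with ∈⋃⁻ T c∈
      ... | t , t∈ , c∈t with T⁻ t∈
      ... | d , d∈ , cr = step (Reach-mono F⊆ (J-connected t c∈t d∈)) e∈ (Cross-sym cr)

      from-e : ∀ {d} → d ∈ M → Reach (F ++ [ e ]) e d
      from-e (here refl) = here e∈
      from-e (there d∈) with ∈⋃⁻ T d∈
      ... | t , t∈ , d∈t with T⁻ t∈
      ... | d₀ , d₀∈ , cr = Reach-trans (step (here e∈) (F⊆ (J⊆F d₀∈)) cr) (Reach-mono F⊆ (J-connected t d₀∈ d∈t))

      connected : ∀ k c d → c ∈ lookup merged k → d ∈ lookup merged k → Reach (F ++ [ e ]) c d
      connected Fin.zero _ _ c∈ d∈ = Reach-trans (to-e c∈) (from-e d∈)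
      connected (Fin.suc k) _ _ c∈ d∈ rewrite lookup-map-preimage J R k =
        Reach-mono F⊆ (J-connected (preimage J R k) c∈ d∈)

      stays-in-R : ∀ {r c d} → ¬ Crossed r → c ∈ J r → Reach (F ++ [ e ]) c d → d ∈ J r
      stays-in-R {r} ¬cr c∈ reach = Reach-invariant (_∈ J r) preserve reach c∈
        where
        preserve : ∀ {c d} → c ∈ J r → d ∈ F ++ [ e ] → Cross c d → d ∈ J r
        preserve c∈ d∈ cr with ∈-++⁻ F d∈
        ... | inj₁ d∈F = Cross-closed c∈ d∈F cr
        ... | inj₂ (here refl) = contradiction (_ , c∈ , Cross-sym cr) ¬cr

      stays-in-M : ∀ {c d} → c ∈ M → Reach (F ++ [ e ]) c d → d ∈ M
      stays-in-M c∈ reach = Reach-invariant (_∈ M) preserve reach c∈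
        where
        preserve : ∀ {c d} → c ∈ M → d ∈ F ++ [ e ] → Cross c d → d ∈ M
        preserve _ d∈ _ with ∈-++⁻ F d∈
        preserve _ _ _ | inj₂ (here refl) = here refl
        preserve (here refl) _ cr | inj₁ d∈F =
          let m , d∈m = ∃-component d∈F in there (∈⋃⁺ (T⁺ (_ , d∈m , cr)) d∈m)
        preserve (there c∈) _ cr | inj₁ d∈F =
          let t , t∈ , c∈t = ∈⋃⁻ T c∈ in there (∈⋃⁺ t∈ (Cross-closed c∈t d∈F cr))

      M∩J⇒Crossed : ∀ {d r} → d ∈ M → d ∈ J r → Crossed r
      M∩J⇒Crossed (here refl) d∈r = contradiction (J⊆F d∈r) e∉F
      M∩J⇒Crossed (there d∈) d∈r = let t , t∈ , d∈t = ∈⋃⁻ T d∈ in subst Crossed (component-unique d∈t d∈r) (T⁻ t∈)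

      separated : ∀ k l c d → k ≢ l → c ∈ lookup merged k → d ∈ lookup merged l → ¬ Reach (F ++ [ e ]) c d
      separated Fin.zero Fin.zero _ _ k≢l _ _ _ = k≢l refl
      separated Fin.zero (Fin.suc l) _ _ _ c∈ d∈ reach rewrite lookup-map-preimage J R l =
        R⁻ (preimage∈ J R l) (M∩J⇒Crossed (stays-in-M c∈ reach) d∈)
      separated (Fin.suc k) Fin.zero _ _ _ c∈ d∈ reach rewrite lookup-map-preimage J R k =
        R⁻ (preimage∈ J R k) (M∩J⇒Crossed d∈ (stays-in-R (R⁻ (preimage∈ J R k)) c∈ reach))
      separated (Fin.suc k) (Fin.suc l) _ _ k≢l c∈ d∈ reach
        rewrite lookup-map-preimage J R k | lookup-map-preimage J R l =
        k≢l (cong Fin.suc (preimage-injective J (filter⁺ (¬? ∘ Crossed?) (allFin⁺ (length Ls))) k l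
          (component-unique (stays-in-R (R⁻ (preimage∈ J R k)) c∈ reach) d∈)))

    singleton-free-merged : ∀ {t} → Crossed t → SingletonFree (F ++ [ e ])
    singleton-free-merged (d , d∈ , cr) =
      AllP.++⁺ (All.map (λ (d′ , d′∈ , cr′) → d′ , F⊆ d′∈ , cr′) singleton-free) ((d , F⊆ (J⊆F d∈) , cr) ∷ [])

    new-vertices-bound : newVerts F [ e ] + length (V (⋃ T)) ≤ length (V M)
    new-vertices-bound =
      subst (_≤ length (V M)) (trans (length-++ (V (⋃ T))) (ℕP.+-comm (length (V (⋃ T))) (newVerts F [ e ]))) (Unique-⊆⇒length≤ Z-unique Z⊆)
      where
      N = offV F (V (F ++ [ e ]))
      ⋃T⊆F : ∀ {v} → v ∈ᵥ ⋃ T → v ∈ᵥ F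
      ⋃T⊆F (c , c∈ , v≡) = let _ , _ , c∈t = ∈⋃⁻ T c∈ in c , J⊆F c∈t , v≡
      Z-unique : Unique (V (⋃ T) ++ N)
      Z-unique = ++⁺ (V-unique (⋃ T)) (filter⁺ (¬? ∘ (_∈? V F)) (V-unique (F ++ [ e ]))) λ (v∈⋃ , v∈N) →
        proj₂ (∈-filter⁻ (¬? ∘ (_∈? V F)) {xs = V (F ++ [ e ])} v∈N) (∈ᵥ⇒∈V F (⋃T⊆F (∈V⇒∈ᵥ (⋃ T) v∈⋃)))
      Z⊆ : V (⋃ T) ++ N ⊆ V M
      Z⊆ v∈ with ∈-++⁻ (V (⋃ T)) v∈
      ... | inj₁ v∈⋃ = let c , c∈ , v≡ = ∈V⇒∈ᵥ (⋃ T) v∈⋃ in ∈ᵥ⇒∈V M (c , there c∈ , v≡)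
      ... | inj₂ v∈N with ∈-filter⁻ (¬? ∘ (_∈? V F)) {xs = V (F ++ [ e ])} v∈N
      ...   | v∈FK , v∉F with ∈V⇒∈ᵥ (F ++ [ e ]) v∈FK
      ...     | c , c∈ , v≡ with ∈-++⁻ F c∈
      ...       | inj₁ c∈F = contradiction (∈ᵥ⇒∈V F (c , c∈F , v≡)) v∉F
      ...       | inj₂ (here refl) = ∈ᵥ⇒∈V M (e , here refl , v≡)

    private
      T-bound : ∀ {i j} → i ≢ j → Crossed i → Crossed j →
        ∃[ t ] (length T ≡ suc t × 1 ≤ t × Σsize T ≤ length (V (⋃ T)) + 2 * t)
      T-bound i≢j cr-i cr-j =
        from-tail T (filter⁺ Crossed? (allFin⁺ (length Ls))) (All.tabulate T⁻) (2≤length (T⁺ cr-i) (T⁺ cr-j) i≢j)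
        where
        from-tail : ∀ T → Unique T → All Crossed T → 2 ≤ length T →
          ∃[ t ] (length T ≡ suc t × 1 ≤ t × Σsize T ≤ length (V (⋃ T)) + 2 * t)
        from-tail (t ∷ T) u cr (s≤s 1≤) = length T , refl , 1≤ , shared-vertices-bound t T u cr

      ΣV-map-J : ∀ I → ΣV (map J I) ≡ Σsize I
      ΣV-map-J I = cong sum (sym (map-∘ I))

    gain-ℤ : ∀ {i j} → i ≢ j → Crossed i → Crossed j →
      + newVerts F [ e ] ℤ.≤ Uval (F ++ [ e ]) merged ℤ.- Uval F Ls
    gain-ℤ i≢j cr-i cr-j with T-bound i≢j cr-i cr-j
    ... | t , |T|≡ , 1≤t , ΣT≤ =
      subst (+ newVerts F [ e ] ℤ.≤_) (sym (cong₂ ℤ._-_ (Uval-≡ (F ++ [ e ]) merged) (Uval-≡ F Ls)))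
        (+≤-difference (subst₂ _≤_ (sym before) (sym after)
          (gain-arithmetic {new = newVerts F [ e ]} {v = length (V (⋃ T))} ΣT≤ new-vertices-bound 1≤t)))
      where
      ΣV-Ls : ΣV Ls ≡ Σsize T + Σsize R
      ΣV-Ls = trans (cong ΣV (sym map-J-allFin))
                (trans (ΣV-map-J (allFin _)) (Σsize-↭ T R (filter++filter-¬↭ Crossed? (allFin _))))
      |Ls|≡ : length Ls ≡ suc t + length R
      |Ls|≡ = trans (sym (length-tabulate (λ k → k)))
                (trans (length-filter-split Crossed? (allFin _)) (cong (_+ length R) |T|≡))
      before : newVerts F [ e ] + ΣV Ls + (length (F ++ [ e ]) + 3 * length merged)
             ≡ newVerts F [ e ] + (Σsize T + Σsize R) + ((length F + 1) + 3 * suc (length R))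
      before = cong₂ (λ s l → newVerts F [ e ] + s + l) ΣV-Ls
                 (cong₂ (λ f r → f + 3 * r) (length-++ F) (cong suc (length-map J R)))
      after : ΣV merged + (length F + 3 * length Ls)
            ≡ (length (V M) + Σsize R) + (length F + 3 * (suc t + length R))
      after = cong₂ _+_ (cong (_+_ (length (V M))) (ΣV-map-J R)) (cong (λ l → length F + 3 * l) |Ls|≡)

    gain : ∀ {α i j} → 0ℚ ℚ.≤ α → i ≢ j → Crossed i → Crossed j →
      (1ℚ ℚ.- α) ℚ.* toℚ (+ newVerts F [ e ]) ℚ.≤ toℚ (Uval (F ++ [ e ]) merged ℤ.- Uval F Ls)
    gain 0≤α i≢j cr-i cr-j =
      scaled-≤ {m = newVerts F [ e ]} {D = Uval (F ++ [ e ]) merged ℤ.- Uval F Ls} 0≤α (gain-ℤ i≢j cr-i cr-j)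

    improving : ∀ {S α Nmax i j} → e ∈ S → 1 ≤ Nmax → 0ℚ ℚ.≤ α → i ≢ j → Crossed i → Crossed j →
      Improving S α Nmax F [ e ]
    improving e∈S 1≤Nmax 0≤α i≢j cr-i cr-j =
      ([] ∷ [] , e∈S ∷ []) , e∉F ∷ [] , ℕP.≤-refl , 1≤Nmax , singleton-free-merged cr-i ,
      merged , Ls , merged-components , comps , gain 0≤α i≢j cr-i cr-j

open import Defs
open import Data.Nat using (ℕ; _≤_)
open import Data.Rational using (ℚ; ½; 1ℚ; _<_)
open import Data.Fin using (Fin)
open import Data.List using (List; length; lookup)
open import Data.List.Membership.Propositional using (_∈_)
open import Relation.Binary.PropositionalEquality using (_≡_)

import Data.Nat as ℕ
import Data.Nat.Properties as ℕP
import Data.Fin.Properties as FinP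
open import Data.Product using (_,_)
open import Data.Product.Properties using (≡-dec)
open import Data.List.Relation.Unary.All as All using (All)
import Data.List.Membership.DecPropositional as DecMembership
open import Relation.Nullary using (yes; no)
open import Relation.Nullary.Decidable using (decidable-stable)
open import Function using (_∘_; case_of_)
open CircleComponents

lemma18 : (n : ℕ) → 4 ≤ n → (S : List Chord) → CycleVCA n S →
    (α : ℚ) → ½ < α → α Data.Rational.≤ 1ℚ → (Nmax : ℕ) → 1 ≤ Nmax →
    (F : List Chord) → SubsetOf F S → Critical S α Nmax F →
    (e : Chord) → e ∈ S →
    (Ls : List (List Chord)) → IsComponents F Ls →
    (i j : Fin (length Ls)) → CrossesComp e (lookup Ls i) → CrossesComp e (lookup Ls j) →
    i ≡ j
lemma18 n _ S (chords , _) α ½<α _ Nmax 1≤Nmax F (_ , F⊆S) (singleton-free , ¬improvable) (a , b) e∈S Ls comps i j cr-i cr-j =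
  case DecMembership._∈?_ (≡-dec ℕ._≟_ ℕ._≟_) (a , b) F of λ where
    (yes e∈F) → Components.crossed-by-member comps e∈F cr-i cr-j
    (no e∉F) → decidable-stable (i FinP.≟ j) λ i≢j →
      ¬improvable (_ , Merging.improving comps ordered singleton-free (IsChord⇒Ordered (All.lookup chords e∈S)) e∉F
                         e∈S 1≤Nmax (½<⇒0≤ ½<α) i≢j cr-i cr-j)
  where
  ordered : All Ordered F
  ordered = All.map (IsChord⇒Ordered ∘ All.lookup chords) F⊆S
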